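{- Let $\tau$ be a self-similar tile set. Then every $\tau$-tiling is aperiodic, i.e., there is no nonzero vector $T\in\mathbb{Z}^2$ with $U(x+T)=U(x)$ for all $x\in\mathbb{Z}^2$, where $U$ is the tiling.
   Context: Fix a finite set $C$ of colors. A tile is a quadruple $(\ell,r,t,b)\in C^4$ (left, right, top, bottom colors); a tile set is a subset $\tau\subset C^4$. A $\tau$-tiling is a map $U\colon\mathbb{Z}^2\to\tau$ such that neighboring tiles match: the right color of $U(x,y)$ equals the left color of $U(x+1,y)$, and the top color of $U(x,y)$ equals the bottom color of $U(x,y+1)$. A tiling is periodic if it has a nonzero period $T\in\mathbb{Z}^2$ ($U(x+T)=U(x)$ for all $x$), otherwise aperiodic. Fix an integer $N>1$. A $\tau$-macro-tile is an $N\times N$ square filled with matching $\tau$-tiles; each side of a macro-tile carries a sequence of $N$ colors (its macro-color). For a set $\rho$ of $\tau$-macro-tiles, $\tau$ simulates $\rho$ if (a) $\tau$-tilings exist, and (b) for every $\tau$-tiling there is a unique grid of vertical and horizontal lines cutting the tiling into $N\times N$ macro-tiles all belonging to $\rho$. Two tile sets (tiles or macro-tiles) are isomorphic if there is a bijection between them preserving the relations "one tile can be placed to the right of another" (right (macro-)color of the first equals left (macro-)color of the second) and "one tile can be placed on top of another" (top of the lower equals bottom of the upper). A tile set $\tau$ is self-similar if, for some $N>1$, $\tau$ simulates some set $\rho$ of $N\times N$ $\tau$-macro-tiles that is isomorphic to $\tau$. -}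

module Defs where

open import Data.Nat using (ℕ; zero; suc; _>_)
open import Data.Bool using (Bool; true)
open import Data.Fin using (Fin; toℕ)
open import Data.Integer using (ℤ; +_; _+_; _*_)
open import Data.Product using (Σ; _×_; _,_; ∃; proj₁)
open import Data.Vec using (Vec; []; _∷_; map; head; last; lookup; tabulate)
open import Relation.Binary.PropositionalEquality using (_≡_)
open import Function.Bundles using (Bijection; _⤖_; _⇔_)

Color : ℕ → Set
Color k = Fin k

record Tile (k : ℕ) : Set where
  constructor tile
  field
    left right top bottom : Color k
open Tile public

TileSet : ℕ → Set
TileSet k = Tile k → Bool

Elem : ∀ {k} → TileSet k → Set
Elem {k} τ = Σ (Tile k) (λ t → τ t ≡ true)

ℤ² : Set
ℤ² = ℤ × ℤ

_+²_ : ℤ² → ℤ² → ℤ²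
(a , b) +² (c , d) = (a + c , b + d)

record IsTiling {k} (τ : TileSet k) (U : ℤ² → Tile k) : Set where
  field
    inSet : ∀ p → τ (U p) ≡ true
    horiz : ∀ x y → right (U (x , y)) ≡ left (U (x + + 1 , y))
    vert  : ∀ x y → top (U (x , y)) ≡ bottom (U (x , y + + 1))

HasPeriod : ∀ {k} → (ℤ² → Tile k) → ℤ² → Set
HasPeriod U T = ∀ p → U (p +² T) ≡ U p

-- An N×N array of tiles: a vector of N columns (x = 0..N-1),
-- each column a vector of N tiles (y = 0..N-1, index 0 at the bottom).
Macro : ℕ → ℕ → Set
Macro k N = Vec (Vec (Tile k) N) N

at : ∀ {k N} → Macro k N → Fin N → Fin N → Tile k
at m i j = lookup (lookup m i) j

record IsMacroTile {k N} (τ : TileSet k) (m : Macro k N) : Set where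
  field
    inSet : ∀ i j → τ (at m i j) ≡ true
    horiz : ∀ (i i' j : Fin N) → toℕ i' ≡ suc (toℕ i) →
            right (at m i j) ≡ left (at m i' j)
    vert  : ∀ (i j j' : Fin N) → toℕ j' ≡ suc (toℕ j) →
            top (at m i j) ≡ bottom (at m i j')

leftM : ∀ {k N} → Macro k N → Vec (Color k) N
leftM [] = []
leftM (c ∷ cs) = map left c

rightM : ∀ {k N} → Macro k N → Vec (Color k) N
rightM [] = []
rightM (c ∷ cs) = map right (last (c ∷ cs))

bottomM : ∀ {k N} → Macro k N → Vec (Color k) N
bottomM {N = zero} m = []
bottomM {N = suc n} m = map (λ col → bottom (head col)) m

topM : ∀ {k N} → Macro k N → Vec (Color k) N
topM {N = zero} m = []
topM {N = suc n} m = map (λ col → top (last col)) m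

MacroSet : ℕ → ℕ → Set
MacroSet k N = Macro k N → Bool

MElem : ∀ {k N} → MacroSet k N → Set
MElem {k} {N} ρ = Σ (Macro k N) (λ m → ρ m ≡ true)

IsMacroSet : ∀ {k N} → TileSet k → MacroSet k N → Set
IsMacroSet τ ρ = ∀ m → ρ m ≡ true → IsMacroTile τ m

block : ∀ {k} (N : ℕ) → (ℤ² → Tile k) → ℤ² → Macro k N
block N U (a , b) =
  tabulate (λ i → tabulate (λ j → U (a + + toℕ i , b + + toℕ j)))

-- Grids are determined by
-- their offset modulo N, so offsets range over Fin N × Fin N.
GoodGrid : ∀ {k} (N : ℕ) → MacroSet k N → (ℤ² → Tile k) → Fin N × Fin N → Set
GoodGrid N ρ U (a , b) =
  ∀ (I J : ℤ) → ρ (block N U (+ toℕ a + + N * I , + toℕ b + + N * J)) ≡ true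

Simulates : ∀ {k N} → TileSet k → MacroSet k N → Set
Simulates {k} {N} τ ρ =
  (∃ λ (U : ℤ² → Tile k) → IsTiling τ U) ×
  (∀ U → IsTiling τ U →
     (∃ λ o → GoodGrid N ρ U o) ×
     (∀ o o' → GoodGrid N ρ U o → GoodGrid N ρ U o' → o ≡ o'))

record Iso {k N} (τ : TileSet k) (ρ : MacroSet k N) : Set where
  field
    f     : Elem τ ⤖ MElem ρ
  open Bijection f using (to)
  field
    horiz : ∀ (s t : Elem τ) →
            (right (proj₁ s) ≡ left (proj₁ t)) ⇔
            (rightM (proj₁ (to s)) ≡ leftM (proj₁ (to t)))
    vert  : ∀ (s t : Elem τ) →
            (top (proj₁ s) ≡ bottom (proj₁ t)) ⇔
            (topM (proj₁ (to s)) ≡ bottomM (proj₁ (to t)))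

SelfSimilar : ∀ {k} → TileSet k → Set
SelfSimilar {k} τ =
  ∃ λ (N : ℕ) → N > 1 × (∃ λ (ρ : MacroSet k N) →
    IsMacroSet τ ρ × Simulates τ ρ × Iso τ ρ)

-- A tiling with a nonzero period T admits a unique good grid of N×N
-- macro-tiles, so translating by T maps the grid to itself and T = N·T'.
-- Reading every macro-tile back through the isomorphism ρ ≅ τ gives a new
-- τ-tiling with period T', and ‖T'‖ < ‖T‖ because N > 1.  Iterating this
-- is an infinite descent in ℕ.
module Submission where

open import Defs
open import Data.Nat as ℕ using (ℕ; suc; NonZero; _<_)
import Data.Nat.Properties as ℕ
open import Data.Integer as ℤ using (ℤ; +_; _+_; _*_; -_; _-_; ∣_∣)
import Data.Integer.Properties as ℤ
open import Data.Integer.DivMod using (_/ℕ_; _%ℕ_; n%ℕd<d; a≡a%ℕn+[a/ℕn]*n)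
open import Data.Integer.Tactic.RingSolver using (solve-∀)
open import Algebra.Properties.CommutativeSemigroup ℤ.+-commutativeSemigroup using (xy∙z≈xz∙y)
open import Data.Bool using (true)
import Data.Bool.Properties as Bool
open import Data.Fin as Fin using (Fin; toℕ; fromℕ; fromℕ<)
import Data.Fin.Properties as Fin
open import Data.Vec using (Vec; map; head; last; tabulate)
import Data.Vec.Properties as Vec
open import Data.Product using (_×_; ∃; ∃₂; _,_; proj₁; proj₂)
open import Function using (_∘_)
open import Function.Bundles using (Bijection; Equivalence)
open import Induction.WellFounded using (module All)
open import Data.Nat.Induction using (<-wellFounded)
open import Relation.Binary.Construct.On as On using ()
open import Relation.Binary.PropositionalEquality
open import Relation.Nullary using (¬_)
open import Axiom.UniquenessOfIdentityProofs using (module Decidable⇒UIP)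

no-infinite-descent : ∀ {a p} {A : Set a} (μ : A → ℕ) (P : A → Set p) →
                      (∀ x → P x → ∃ λ y → P y × μ y < μ x) → ∀ x → ¬ P x
no-infinite-descent μ P descend =
  All.wfRec (On.wellFounded μ <-wellFounded) _ (λ x → ¬ P x) step
  where
  step : ∀ x → (∀ {y} → μ y < μ x → ¬ P y) → ¬ P x
  step x ih px with descend x px
  ... | y , py , μy<μx = ih μy<μx py

MElem-≡ : ∀ {k N} {ρ : MacroSet k N} {m m' : MElem ρ} → proj₁ m ≡ proj₁ m' → m ≡ m'
MElem-≡ {m = m , p} {m' = .m , p'} refl =
  cong (m ,_) (Decidable⇒UIP.≡-irrelevant Bool._≟_ p p')

last-tabulate : ∀ {A : Set} n (f : Fin (suc n) → A) → last (tabulate f) ≡ f (fromℕ n)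
last-tabulate ℕ.zero f = refl
last-tabulate (suc n) f = last-tabulate n (f ∘ Fin.suc)

0² : ℤ²
0² = (+ 0 , + 0)

_·²_ : ℕ → ℤ² → ℤ²
n ·² (a , b) = (a * + n , b * + n)

‖_‖ : ℤ² → ℕ
‖ (a , b) ‖ = ∣ a ∣ ℕ.+ ∣ b ∣

‖‖≡0⇒≡0² : ∀ T → ‖ T ‖ ≡ 0 → T ≡ 0²
‖‖≡0⇒≡0² (a , b) ‖T‖≡0 =
  cong₂ _,_ (ℤ.∣i∣≡0⇒i≡0 (ℕ.m+n≡0⇒m≡0 ∣ a ∣ ‖T‖≡0))
            (ℤ.∣i∣≡0⇒i≡0 (ℕ.m+n≡0⇒n≡0 ∣ a ∣ ‖T‖≡0))

‖·²‖ : ∀ n T → ‖ n ·² T ‖ ≡ ‖ T ‖ ℕ.* n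
‖·²‖ n (a , b) = begin
  ∣ a * + n ∣ ℕ.+ ∣ b * + n ∣     ≡⟨ cong₂ ℕ._+_ (ℤ.∣i*j∣≡∣i∣*∣j∣ a (+ n)) (ℤ.∣i*j∣≡∣i∣*∣j∣ b (+ n)) ⟩
  ∣ a ∣ ℕ.* n ℕ.+ ∣ b ∣ ℕ.* n     ≡⟨ ℕ.*-distribʳ-+ n ∣ a ∣ ∣ b ∣ ⟨
  (∣ a ∣ ℕ.+ ∣ b ∣) ℕ.* n          ∎
  where open ≡-Reasoning

·²-≢0² : ∀ {n T} → n ·² T ≢ 0² → T ≢ 0²
·²-≢0² n·T≢0 refl = n·T≢0 refl

‖‖<‖·²‖ : ∀ {n T} → 1 < n → T ≢ 0² → ‖ T ‖ < ‖ n ·² T ‖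
‖‖<‖·²‖ {n} {T} 1<n T≢0 =
  subst (‖ T ‖ <_) (sym (‖·²‖ n T))
        (ℕ.m<m*n ‖ T ‖ n {{ℕ.≢-nonZero (T≢0 ∘ ‖‖≡0⇒≡0² T)}} 1<n)

block-periodic : ∀ {k} N {U : ℤ² → Tile k} {T} → HasPeriod U T →
                 ∀ p → block N U (p +² T) ≡ block N U p
block-periodic N {U} {t₁ , t₂} period (x , y) =
  Vec.tabulate-cong λ i → Vec.tabulate-cong λ j →
    trans (cong U (cong₂ _,_ (xy∙z≈xz∙y x t₁ (+ toℕ i)) (xy∙z≈xz∙y y t₂ (+ toℕ j))))
          (period (x + + toℕ i , y + + toℕ j))

gridLine : ∀ {N} → Fin N → ℤ → ℤ
gridLine {N} c I = + toℕ c + + N * I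

gridLine-+ : ∀ {N} (c : Fin N) I q → gridLine c (I + q) ≡ gridLine c I + q * + N
gridLine-+ {N} c I q = distrib (+ toℕ c) (+ N) I q
  where
  distrib : ∀ c m I q → c + m * (I + q) ≡ (c + m * I) + q * m
  distrib = solve-∀

gridLine-suc : ∀ {N} (c : Fin N) I → gridLine c (I + + 1) ≡ gridLine c I + + N
gridLine-suc {N} c I = distrib (+ toℕ c) (+ N) I
  where
  distrib : ∀ c m I → c + m * (I + + 1) ≡ (c + m * I) + m
  distrib = solve-∀

module _ (N : ℕ) .{{_ : NonZero N}} where

  residue : ℤ → Fin N
  residue c = fromℕ< (n%ℕd<d c N)

  residue-decomposition : ∀ c → + toℕ (residue c) + (c /ℕ N) * + N ≡ c
  residue-decomposition c = begin
    + toℕ (residue c) + (c /ℕ N) * + N  ≡⟨ cong (λ r → + r + (c /ℕ N) * + N) (Fin.toℕ-fromℕ< _) ⟩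
    + (c %ℕ N) + (c /ℕ N) * + N         ≡⟨ a≡a%ℕn+[a/ℕn]*n c N ⟨
    c                                    ∎
    where open ≡-Reasoning

  gridLine-translate : ∀ (a : Fin N) t I →
    gridLine (residue (+ toℕ a + t)) I ≡ gridLine a (I - (+ toℕ a + t) /ℕ N) + t
  gridLine-translate a t I = begin
    r + + N * I                   ≡⟨ regroup r q (+ N) I ⟩
    (r + q * + N) + + N * (I - q) ≡⟨ cong (_+ + N * (I - q)) (residue-decomposition c) ⟩
    (+ toℕ a + t) + + N * (I - q) ≡⟨ xy∙z≈xz∙y (+ toℕ a) t (+ N * (I - q)) ⟩
    (+ toℕ a + + N * (I - q)) + t ∎
    where
    open ≡-Reasoning
    c = + toℕ a + t
    q = c /ℕ N
    r = + toℕ (residue c)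
    regroup : ∀ r q n I → r + n * I ≡ (r + q * n) + n * (I - q)
    regroup = solve-∀

  residue-fixed⇒multiple : ∀ (a : Fin N) t → residue (+ toℕ a + t) ≡ a →
                           t ≡ ((+ toℕ a + t) /ℕ N) * + N
  residue-fixed⇒multiple a t fixed = begin
    t                           ≡⟨ cancel (+ toℕ a) t ⟩
    - (+ toℕ a) + (+ toℕ a + t) ≡⟨ cong (λ z → - (+ toℕ a) + z) decomposition ⟨
    - (+ toℕ a) + (+ toℕ a + m) ≡⟨ cancel (+ toℕ a) m ⟨
    m                           ∎
    where
    open ≡-Reasoning
    m = ((+ toℕ a + t) /ℕ N) * + N
    decomposition : + toℕ a + m ≡ + toℕ a + t
    decomposition =
      trans (cong (λ r → + toℕ r + m) (sym fixed)) (residue-decomposition (+ toℕ a + t))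
    cancel : ∀ a t → t ≡ - a + (a + t)
    cancel = solve-∀

GoodGrid-translate : ∀ {k} N .{{_ : NonZero N}} {ρ : MacroSet k N} {U : ℤ² → Tile k} {t₁ t₂} →
                     HasPeriod U (t₁ , t₂) → ∀ {a b} → GoodGrid N ρ U (a , b) →
                     GoodGrid N ρ U (residue N (+ toℕ a + t₁) , residue N (+ toℕ b + t₂))
GoodGrid-translate N {ρ} {U} {t₁} {t₂} period {a} {b} grid I J =
  subst (λ m → ρ m ≡ true) (sym translated) (grid (I - q₁) (J - q₂))
  where
  q₁ = (+ toℕ a + t₁) /ℕ N
  q₂ = (+ toℕ b + t₂) /ℕ N
  translated : block N U (gridLine (residue N (+ toℕ a + t₁)) I , gridLine (residue N (+ toℕ b + t₂)) J)
             ≡ block N U (gridLine a (I - q₁) , gridLine b (J - q₂))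
  translated =
    trans (cong (block N U) (cong₂ _,_ (gridLine-translate N a t₁ I) (gridLine-translate N b t₂ J)))
          (block-periodic N period (gridLine a (I - q₁) , gridLine b (J - q₂)))

period-multiple : ∀ {k} N .{{_ : NonZero N}} {ρ : MacroSet k N} {U : ℤ² → Tile k} →
                  (∀ o o' → GoodGrid N ρ U o → GoodGrid N ρ U o' → o ≡ o') →
                  ∀ {o} → GoodGrid N ρ U o → ∀ {T} → HasPeriod U T → ∃ λ T' → T ≡ N ·² T'
period-multiple N {ρ} unique {a , b} grid {t₁ , t₂} period =
  ((+ toℕ a + t₁) /ℕ N , (+ toℕ b + t₂) /ℕ N) ,
  cong₂ _,_ (residue-fixed⇒multiple N a t₁ (cong proj₁ fixed))
            (residue-fixed⇒multiple N b t₂ (cong proj₂ fixed))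
  where
  fixed : (residue N (+ toℕ a + t₁) , residue N (+ toℕ b + t₂)) ≡ (a , b)
  fixed = unique _ _ (GoodGrid-translate N {ρ} period {a} {b} grid) grid

module _ {k} {τ : TileSet k} {U : ℤ² → Tile k} (tiling : IsTiling τ U) (n : ℕ) where

  private
    -- The solver cannot see + suc n, but + 1 + + n reduces to it.
    past-edge : ∀ x → x + + n + + 1 ≡ (x + + suc n) + + 0
    past-edge x = shift x (+ n)
      where
      shift : ∀ x m → x + m + + 1 ≡ (x + (+ 1 + m)) + + 0
      shift = solve-∀

  rightM-block : ∀ x y → rightM (block (suc n) U (x , y)) ≡ leftM (block (suc n) U (x + + suc n , y))
  rightM-block x y = begin
    map right (last (tabulate column))
      ≡⟨ cong (map right) (last-tabulate n column) ⟩
    map right (column (fromℕ n))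
      ≡⟨ Vec.tabulate-∘ right (λ j → U (x + + toℕ (fromℕ n) , y + + toℕ j)) ⟨
    tabulate (λ j → right (U (x + + toℕ (fromℕ n) , y + + toℕ j)))
      ≡⟨ Vec.tabulate-cong matching ⟩
    tabulate (λ j → left (U ((x + + suc n) + + 0 , y + + toℕ j)))
      ≡⟨ Vec.tabulate-∘ left (λ j → U ((x + + suc n) + + 0 , y + + toℕ j)) ⟩
    leftM (block (suc n) U (x + + suc n , y))
      ∎
    where
    open ≡-Reasoning
    column : Fin (suc n) → Vec (Tile k) (suc n)
    column i = tabulate λ j → U (x + + toℕ i , y + + toℕ j)
    matching : ∀ j → right (U (x + + toℕ (fromℕ n) , y + + toℕ j))
                   ≡ left (U ((x + + suc n) + + 0 , y + + toℕ j))
    matching j = begin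
      right (U (x + + toℕ (fromℕ n) , y + + toℕ j))
        ≡⟨ cong (λ c → right (U (x + + c , y + + toℕ j))) (Fin.toℕ-fromℕ n) ⟩
      right (U (x + + n , y + + toℕ j))
        ≡⟨ IsTiling.horiz tiling (x + + n) (y + + toℕ j) ⟩
      left (U (x + + n + + 1 , y + + toℕ j))
        ≡⟨ cong (λ x′ → left (U (x′ , y + + toℕ j))) (past-edge x) ⟩
      left (U ((x + + suc n) + + 0 , y + + toℕ j))
        ∎

  topM-block : ∀ x y → topM (block (suc n) U (x , y)) ≡ bottomM (block (suc n) U (x , y + + suc n))
  topM-block x y = begin
    map (top ∘ last) (tabulate column)
      ≡⟨ Vec.tabulate-∘ (top ∘ last) column ⟨
    tabulate (top ∘ last ∘ column)
      ≡⟨ Vec.tabulate-cong matching ⟩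
    tabulate (λ i → bottom (U (x + + toℕ i , (y + + suc n) + + 0)))
      ≡⟨ Vec.tabulate-∘ (bottom ∘ head) (λ i → tabulate λ j → U (x + + toℕ i , (y + + suc n) + + toℕ j)) ⟩
    bottomM (block (suc n) U (x , y + + suc n))
      ∎
    where
    open ≡-Reasoning
    column : Fin (suc n) → Vec (Tile k) (suc n)
    column i = tabulate λ j → U (x + + toℕ i , y + + toℕ j)
    matching : ∀ i → top (last (column i)) ≡ bottom (U (x + + toℕ i , (y + + suc n) + + 0))
    matching i = begin
      top (last (column i))
        ≡⟨ cong top (last-tabulate n (λ j → U (x + + toℕ i , y + + toℕ j))) ⟩
      top (U (x + + toℕ i , y + + toℕ (fromℕ n)))
        ≡⟨ cong (λ c → top (U (x + + toℕ i , y + + c))) (Fin.toℕ-fromℕ n) ⟩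
      top (U (x + + toℕ i , y + + n))
        ≡⟨ IsTiling.vert tiling (x + + toℕ i) (y + + n) ⟩
      bottom (U (x + + toℕ i , y + + n + + 1))
        ≡⟨ cong (λ y′ → bottom (U (x + + toℕ i , y′))) (past-edge y) ⟩
      bottom (U (x + + toℕ i , (y + + suc n) + + 0))
        ∎

module Deflation {k n} {τ : TileSet k} {ρ : MacroSet k (suc n)} (iso : Iso τ ρ)
                 {U : ℤ² → Tile k} (tiling : IsTiling τ U)
                 {a b : Fin (suc n)} (grid : GoodGrid (suc n) ρ U (a , b)) where

  open Bijection (Iso.f iso) using (to; to⁻; strictlySurjective)
  open ≡-Reasoning

  macroTile : ℤ → ℤ → MElem ρ
  macroTile I J = block (suc n) U (gridLine a I , gridLine b J) , grid I J

  tileOf : ℤ → ℤ → Elem τ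
  tileOf I J = to⁻ (macroTile I J)

  macroTile-tileOf : ∀ I J → proj₁ (to (tileOf I J)) ≡ proj₁ (macroTile I J)
  macroTile-tileOf I J = cong proj₁ (proj₂ (strictlySurjective (macroTile I J)))

  deflate : ℤ² → Tile k
  deflate (I , J) = proj₁ (tileOf I J)

  deflate-isTiling : IsTiling τ deflate
  IsTiling.inSet deflate-isTiling (I , J) = proj₂ (tileOf I J)
  IsTiling.horiz deflate-isTiling I J =
    Equivalence.from (Iso.horiz iso (tileOf I J) (tileOf (I + + 1) J)) (begin
      rightM (proj₁ (to (tileOf I J)))
        ≡⟨ cong rightM (macroTile-tileOf I J) ⟩
      rightM (block (suc n) U (gridLine a I , gridLine b J))
        ≡⟨ rightM-block tiling n (gridLine a I) (gridLine b J) ⟩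
      leftM (block (suc n) U (gridLine a I + + suc n , gridLine b J))
        ≡⟨ cong (λ x → leftM (block (suc n) U (x , gridLine b J))) (gridLine-suc a I) ⟨
      leftM (block (suc n) U (gridLine a (I + + 1) , gridLine b J))
        ≡⟨ cong leftM (macroTile-tileOf (I + + 1) J) ⟨
      leftM (proj₁ (to (tileOf (I + + 1) J)))
        ∎)
  IsTiling.vert deflate-isTiling I J =
    Equivalence.from (Iso.vert iso (tileOf I J) (tileOf I (J + + 1))) (begin
      topM (proj₁ (to (tileOf I J)))
        ≡⟨ cong topM (macroTile-tileOf I J) ⟩
      topM (block (suc n) U (gridLine a I , gridLine b J))
        ≡⟨ topM-block tiling n (gridLine a I) (gridLine b J) ⟩
      bottomM (block (suc n) U (gridLine a I , gridLine b J + + suc n))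
        ≡⟨ cong (λ y → bottomM (block (suc n) U (gridLine a I , y))) (gridLine-suc b J) ⟨
      bottomM (block (suc n) U (gridLine a I , gridLine b (J + + 1)))
        ≡⟨ cong bottomM (macroTile-tileOf I (J + + 1)) ⟨
      bottomM (proj₁ (to (tileOf I (J + + 1))))
        ∎)

  deflate-periodic : ∀ {T} → HasPeriod U (suc n ·² T) → HasPeriod deflate T
  deflate-periodic {q₁ , q₂} period (I , J) =
    cong (proj₁ ∘ to⁻) (MElem-≡ (begin
      block (suc n) U (gridLine a (I + q₁) , gridLine b (J + q₂))
        ≡⟨ cong₂ (λ x y → block (suc n) U (x , y)) (gridLine-+ a I q₁) (gridLine-+ b J q₂) ⟩
      block (suc n) U ((gridLine a I , gridLine b J) +² (suc n ·² (q₁ , q₂)))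
        ≡⟨ block-periodic (suc n) period (gridLine a I , gridLine b J) ⟩
      block (suc n) U (gridLine a I , gridLine b J) ∎))

periodic-tiling-deflates : ∀ {k n} {τ : TileSet k} {ρ : MacroSet k (suc n)} → Simulates τ ρ → Iso τ ρ →
                           ∀ {U T} → IsTiling τ U → HasPeriod U T →
                           ∃₂ λ U′ T′ → IsTiling τ U′ × HasPeriod U′ T′ × T ≡ suc n ·² T′
periodic-tiling-deflates {n = n} {ρ = ρ} (_ , grids) iso {U} tiling period
  with grids U tiling
... | (_ , grid) , unique with period-multiple (suc n) {ρ} unique grid period
... | T′ , refl = deflate , T′ , deflate-isTiling , deflate-periodic period , refl
  where open Deflation iso tiling grid

theorem2 : ∀ {k : ℕ} (τ : TileSet k) → SelfSimilar τ →
           ∀ (U : ℤ² → Tile k) → IsTiling τ U →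
           ∀ (T : ℤ²) → T ≢ (+ 0 , + 0) → ¬ HasPeriod U T
theorem2 τ (ℕ.zero , () , _)
theorem2 {k} τ (suc n , 1<N , ρ , _ , simulation , iso) U tiling T T≢0 period =
  no-infinite-descent (‖_‖ ∘ proj₂) PeriodicTiling descend (U , T) (tiling , T≢0 , period)
  where
  PeriodicTiling : (ℤ² → Tile k) × ℤ² → Set
  PeriodicTiling (U , T) = IsTiling τ U × T ≢ 0² × HasPeriod U T

  descend : ∀ x → PeriodicTiling x → ∃ λ y → PeriodicTiling y × ‖ proj₂ y ‖ < ‖ proj₂ x ‖
  descend (U , T) (tiling , T≢0 , period)
    with periodic-tiling-deflates {ρ = ρ} simulation iso tiling period
  ... | U′ , T′ , tiling′ , period′ , refl =
    (U′ , T′) , (tiling′ , ·²-≢0² T≢0 , period′) , ‖‖<‖·²‖ {suc n} {T′} 1<N (·²-≢0² T≢0)
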